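{- Let $\Gamma$ and $\Sigma$ be two connected graphs, each with at least two vertices. Then: (i) if one of $\Gamma$ and $\Sigma$ is bipartite and the other has a TF-morphism $(\alpha,\beta)$ with $\alpha\ne\beta$, then $\Gamma\Box\Sigma$ is unstable; (ii) if one of $\Gamma$ and $\Sigma$ is bipartite and the other is $R$-thick, then $\Gamma\boxtimes\Sigma$ is unstable; (iii) if $\Gamma$ or $\Sigma$ has a TFS-morphism, then the complement $\overline{\Gamma\boxtimes\Sigma}$ is unstable; (iv) if $\Sigma$ is unstable or $\Gamma$ has a TFS-morphism, then $\Gamma\ltimes\Sigma$ is unstable; (v) if $\Sigma$ has a TF-morphism $(\alpha,\beta)$ with $\alpha\ne\beta$, then $\Gamma[\Sigma]$ is unstable.
   Context: All graphs are finite, undirected and simple. For a permutation $\alpha$ and point $x$, $x^\alpha$ denotes the image of $x$. A TF-morphism of a graph $\Gamma$ is an ordered pair $(\alpha,\beta)$ of permutations of $V(\Gamma)$ such that $u\sim_\Gamma v$ implies $u^\alpha\sim_\Gamma v^\beta$. A TFS-morphism of $\Gamma$ is an ordered pair $(\alpha,\beta)$ of permutations of $V(\Gamma)$ such that $u^\alpha\sim_\Gamma u^\beta$ for every vertex $u$, and for every pair of adjacent vertices $u,v$, either $u^\alpha\sim_\Gamma v^\beta$ or $u^\alpha=v^\beta$. A graph is $R$-thick if two distinct vertices have the same neighbourhood. The complement $\overline{\Lambda}$ has the same vertex set, with $u\sim v$ iff $u\ne v$ and $u\not\sim_\Lambda v$. All products below have vertex set $V(\Gamma)\times V(\Sigma)$: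 in the Cartesian product $\Gamma\Box\Sigma$, $(a,x)\sim(b,y)$ iff ($a=b$ and $x\sim_\Sigma y$) or ($a\sim_\Gamma b$ and $x=y$); in the strong product $\Gamma\boxtimes\Sigma$, iff ($a=b$ and $x\sim_\Sigma y$) or ($a\sim_\Gamma b$ and $x\sim_\Sigma y$) or ($a\sim_\Gamma b$ and $x=y$); in the semi-strong product $\Gamma\ltimes\Sigma$, iff ($a\sim_\Gamma b$ or $a=b$) and $x\sim_\Sigma y$; in the lexicographic product $\Gamma[\Sigma]$, iff $a\sim_\Gamma b$, or ($a=b$ and $x\sim_\Sigma y$). The direct product $\Lambda\times K_2$ has vertex set $V(\Lambda)\times V(K_2)$ with $(a,x)\sim(b,y)$ iff $a\sim b$ and $x\sim y$; $\mathrm{Aut}(\Lambda)\times\mathrm{Aut}(K_2)$ acts coordinatewise on it. A graph $\Lambda$ is stable if $\mathrm{Aut}(\Lambda\times K_2)=\mathrm{Aut}(\Lambda)\times\mathrm{Aut}(K_2)$ and unstable otherwise. -}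

module Defs where

open import Data.Nat using (ℕ; _*_)
open import Data.Fin using (Fin)
open import Data.Fin.Properties using (*↔×)
open import Data.Bool using (Bool; true; false)
open import Data.Product using (Σ; ∃; ∃-syntax; _×_; _,_; proj₁; proj₂)
open import Data.Sum using (_⊎_; inj₁; inj₂)
open import Data.Empty using (⊥)
open import Relation.Nullary using (¬_)
open import Relation.Binary.PropositionalEquality using (_≡_; _≢_; refl; sym)
open import Function using (_↔_; _⇔_; Inverse)
open import Function.Properties.Inverse using (↔-sym; ↔-trans)
open import Data.Product.Function.NonDependent.Propositional using (_×-↔_)

record Graph : Set₁ where
  field
    V      : Set
    _∼_    : V → V → Set
    ∼-sym  : ∀ {u v} → u ∼ v → v ∼ u
    ∼-irr  : ∀ {u} → ¬ (u ∼ u)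
    size   : ℕ
    finite : V ↔ Fin size

open Graph public

Perm : Set → Set
Perm A = A ↔ A

_⟨$⟩_ : ∀ {A : Set} → Perm A → A → A
α ⟨$⟩ x = Inverse.to α x

data Walk (Γ : Graph) : V Γ → V Γ → Set where
  here  : ∀ {u} → Walk Γ u u
  step  : ∀ {u v w} → _∼_ Γ u v → Walk Γ v w → Walk Γ u w

Connected : Graph → Set
Connected Γ = ∀ (u v : V Γ) → Walk Γ u v

AtLeastTwoVertices : Graph → Set
AtLeastTwoVertices Γ = Σ (V Γ) λ u → Σ (V Γ) λ v → u ≢ v

Bipartite : Graph → Set
Bipartite Γ = Σ (V Γ → Bool) λ c → ∀ {u v} → _∼_ Γ u v → c u ≢ c v

RThick : Graph → Set
RThick Γ = Σ (V Γ) λ u → Σ (V Γ) λ v → u ≢ v × (∀ w → (_∼_ Γ w u ⇔ _∼_ Γ w v))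

IsTF : (Γ : Graph) → Perm (V Γ) → Perm (V Γ) → Set
IsTF Γ α β = ∀ {u v} → _∼_ Γ u v → _∼_ Γ (α ⟨$⟩ u) (β ⟨$⟩ v)

HasNontrivialTF : Graph → Set
HasNontrivialTF Γ = Σ (Perm (V Γ)) λ α → Σ (Perm (V Γ)) λ β →
  IsTF Γ α β × ¬ (∀ x → α ⟨$⟩ x ≡ β ⟨$⟩ x)

IsTFS : (Γ : Graph) → Perm (V Γ) → Perm (V Γ) → Set
IsTFS Γ α β =
  (∀ u → _∼_ Γ (α ⟨$⟩ u) (β ⟨$⟩ u)) ×
  (∀ {u v} → _∼_ Γ u v → (_∼_ Γ (α ⟨$⟩ u) (β ⟨$⟩ v) ⊎ (α ⟨$⟩ u ≡ β ⟨$⟩ v)))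

HasTFS : Graph → Set
HasTFS Γ = Σ (Perm (V Γ)) λ α → Σ (Perm (V Γ)) λ β → IsTFS Γ α β

private
  prodFinite : ∀ {A B : Set} {n m : ℕ} → A ↔ Fin n → B ↔ Fin m → (A × B) ↔ Fin (n * m)
  prodFinite f g = ↔-trans (f ×-↔ g) (↔-sym *↔×)

_□_ : Graph → Graph → Graph
Γ □ Σ' = record
  { V = V Γ × V Σ'
  ; _∼_ = λ p q → ((proj₁ p ≡ proj₁ q) × _∼_ Σ' (proj₂ p) (proj₂ q))
                ⊎ (_∼_ Γ (proj₁ p) (proj₁ q) × (proj₂ p ≡ proj₂ q))
  ; ∼-sym = λ { (inj₁ (e , s)) → inj₁ (sym e , ∼-sym Σ' s)
              ; (inj₂ (s , e)) → inj₂ (∼-sym Γ s , sym e) }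
  ; ∼-irr = λ { (inj₁ (_ , s)) → ∼-irr Σ' s ; (inj₂ (s , _)) → ∼-irr Γ s }
  ; size = size Γ * size Σ'
  ; finite = prodFinite (finite Γ) (finite Σ')
  }

_⊠_ : Graph → Graph → Graph
Γ ⊠ Σ' = record
  { V = V Γ × V Σ'
  ; _∼_ = λ p q → ((proj₁ p ≡ proj₁ q) × _∼_ Σ' (proj₂ p) (proj₂ q))
                ⊎ ((_∼_ Γ (proj₁ p) (proj₁ q) × _∼_ Σ' (proj₂ p) (proj₂ q))
                ⊎ (_∼_ Γ (proj₁ p) (proj₁ q) × (proj₂ p ≡ proj₂ q)))
  ; ∼-sym = λ { (inj₁ (e , s)) → inj₁ (sym e , ∼-sym Σ' s)
              ; (inj₂ (inj₁ (s , t))) → inj₂ (inj₁ (∼-sym Γ s , ∼-sym Σ' t))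
              ; (inj₂ (inj₂ (s , e))) → inj₂ (inj₂ (∼-sym Γ s , sym e)) }
  ; ∼-irr = λ { (inj₁ (_ , s)) → ∼-irr Σ' s
              ; (inj₂ (inj₁ (s , _))) → ∼-irr Γ s
              ; (inj₂ (inj₂ (s , _))) → ∼-irr Γ s }
  ; size = size Γ * size Σ'
  ; finite = prodFinite (finite Γ) (finite Σ')
  }

_⋉_ : Graph → Graph → Graph
Γ ⋉ Σ' = record
  { V = V Γ × V Σ'
  ; _∼_ = λ p q → (_∼_ Γ (proj₁ p) (proj₁ q) ⊎ (proj₁ p ≡ proj₁ q))
                × _∼_ Σ' (proj₂ p) (proj₂ q)
  ; ∼-sym = λ { (inj₁ s , t) → inj₁ (∼-sym Γ s) , ∼-sym Σ' t
              ; (inj₂ e , t) → inj₂ (sym e) , ∼-sym Σ' t }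
  ; ∼-irr = λ { (_ , t) → ∼-irr Σ' t }
  ; size = size Γ * size Σ'
  ; finite = prodFinite (finite Γ) (finite Σ')
  }

lex : Graph → Graph → Graph
lex Γ Σ' = record
  { V = V Γ × V Σ'
  ; _∼_ = λ p q → _∼_ Γ (proj₁ p) (proj₁ q)
                ⊎ ((proj₁ p ≡ proj₁ q) × _∼_ Σ' (proj₂ p) (proj₂ q))
  ; ∼-sym = λ { (inj₁ s) → inj₁ (∼-sym Γ s)
              ; (inj₂ (e , t)) → inj₂ (sym e , ∼-sym Σ' t) }
  ; ∼-irr = λ { (inj₁ s) → ∼-irr Γ s ; (inj₂ (_ , t)) → ∼-irr Σ' t }
  ; size = size Γ * size Σ'
  ; finite = prodFinite (finite Γ) (finite Σ')
  }

complement : Graph → Graph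
complement Λ = record
  { V = V Λ
  ; _∼_ = λ u v → (u ≢ v) × ¬ (_∼_ Λ u v)
  ; ∼-sym = λ { (ne , na) → (λ e → ne (sym e)) , (λ a → na (∼-sym Λ a)) }
  ; ∼-irr = λ { (ne , _) → ne refl }
  ; size = size Λ
  ; finite = finite Λ
  }

K₂ : Graph
K₂ = record
  { V = Bool
  ; _∼_ = λ x y → x ≢ y
  ; ∼-sym = λ ne e → ne (sym e)
  ; ∼-irr = λ ne → ne refl
  ; size = 2
  ; finite = boolFin
  }
  where
  open import Data.Fin using (zero; suc)
  open import Function using (mk↔ₛ′)
  to : Bool → Fin 2
  to false = zero
  to true  = suc zero
  from : Fin 2 → Bool
  from zero = false
  from (suc zero) = true
  boolFin : Bool ↔ Fin 2
  boolFin = mk↔ₛ′ to from (λ { zero → refl ; (suc zero) → refl })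
                          (λ { false → refl ; true → refl })

_×K₂ : Graph → Graph
Λ ×K₂ = record
  { V = V Λ × Bool
  ; _∼_ = λ p q → _∼_ Λ (proj₁ p) (proj₁ q) × (proj₂ p ≢ proj₂ q)
  ; ∼-sym = λ { (s , ne) → ∼-sym Λ s , (λ e → ne (sym e)) }
  ; ∼-irr = λ { (s , _) → ∼-irr Λ s }
  ; size = size Λ * 2
  ; finite = prodFinite (finite Λ) (finite K₂)
  }

IsAut : (Γ : Graph) → Perm (V Γ) → Set
IsAut Γ φ = ∀ u v → (_∼_ Γ u v ⇔ _∼_ Γ (φ ⟨$⟩ u) (φ ⟨$⟩ v))

Aut : Graph → Set
Aut Γ = Σ (Perm (V Γ)) (IsAut Γ)

InProductAut : (Λ : Graph) → Aut (Λ ×K₂) → Set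
InProductAut Λ φ =
  Σ (Aut Λ) λ σ → Σ (Aut K₂) λ τ →
    ∀ (p : V Λ × Bool) →
      proj₁ φ ⟨$⟩ p ≡ (proj₁ σ ⟨$⟩ proj₁ p , proj₁ τ ⟨$⟩ proj₂ p)

Stable : Graph → Set
Stable Λ = ∀ (φ : Aut (Λ ×K₂)) → InProductAut Λ φ

-- Aut(Λ) × Aut(K₂) ⊆ Aut(Λ × K₂) always holds, so Λ is unstable iff
-- some automorphism of Λ × K₂ is not of product form.
Unstable : Graph → Set
Unstable Λ = Σ (Aut (Λ ×K₂)) λ φ → ¬ InProductAut Λ φ

{-# OPTIONS --safe #-}

-- A TF-morphism (α , β) of a finite graph Λ is a two-fold automorphism: the permutation
-- (u , v) ↦ (α u , β v) of the finite set V Λ × V Λ has finite order, so it reflects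
-- adjacency as well as preserving it. Then (x , false) ↦ (α x , false), (x , true) ↦
-- (β x , true) is an automorphism of Λ × K₂, which has product form only if α = β.
-- Most parts therefore reduce to a TF-morphism α ≠ β of the product. Over a bipartite
-- factor, the fibre above a vertex gets (α , β) or (β , α) according to its colour, so that
-- the fibres above the two ends of an edge carry the same permutation; an R-thick factor
-- provides (id , transposition of two twins); a TFS-morphism preserves adjacency-or-equality,
-- whose negation is the adjacency of the complement and whose product is that of the strong
-- product. Finally, an automorphism of Σ × K₂ acts on (Γ ⋉ Σ) × K₂ fibrewise over Γ, and a
-- product decomposition of that action restricts to one of the original automorphism.

module Submission where

open import Defs
open import Data.Bool using (Bool; true; false; if_then_else_)
open import Data.Fin using (Fin; toℕ)
open import Data.Fin.Properties using (pigeonhole; *↔×; inj⇒≟)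
open import Data.Nat using (zero; suc; _+_)
open import Data.Nat.Properties using (n<1+n; m≤n⇒∃[o]m+o≡n; +-suc; +-comm)
open import Data.Product using (Σ; ∃-syntax; _×_; _,_; proj₁; proj₂; uncurry)
open import Data.Product.Algebra using (×-assoc; ×-comm)
open import Data.Product.Function.NonDependent.Propositional using (_×-↔_)
open import Data.Product.Relation.Binary.Pointwise.NonDependent using (Pointwise)
open import Data.Sum using (_⊎_; inj₁; inj₂; [_,_]′)
open import Function using (_↔_; _⇔_; Inverse; Equivalence; Injection; mk↔ₛ′; mk⇔; _∘_)
open import Function.Properties.Inverse using (↔-refl; ↔-sym; ↔-trans; ↔⇒↣)
open import Level using (0ℓ)
open import Relation.Binary.Construct.Union using (_∪_)
open import Relation.Binary.Definitions using (DecidableEquality)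
open import Relation.Binary.PropositionalEquality
open import Relation.Nullary using (¬_; yes; no)
open import Relation.Nullary.Negation using (contradiction)

↔-injective : {A B : Set} (π : A ↔ B) {x y : A} → Inverse.to π x ≡ Inverse.to π y → x ≡ y
↔-injective π = Injection.injective (↔⇒↣ π)

module _ {A : Set} (π : Perm A) where
  open import Function.Endo.Propositional A using (_^_; ^-homo)

  private
    f : A → A
    f = π ⟨$⟩_

  ^-homo-at : ∀ m n x → (f ^ (m + n)) x ≡ (f ^ m) ((f ^ n) x)
  ^-homo-at m n = cong-app (^-homo f m n)

  ^-injective : ∀ k {x y} → (f ^ k) x ≡ (f ^ k) y → x ≡ y
  ^-injective zero    eq = eq
  ^-injective (suc k) eq = ^-injective k (↔-injective π eq)

  finitePerm-periodic : ∀ {n} → A ↔ Fin n → ∀ x → ∃[ d ] (f ^ suc d) x ≡ x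
  finitePerm-periodic {n} fin x =
    let i , j , i<j , fⁱ≡fʲ =
          pigeonhole (n<1+n n) (λ k → Inverse.to fin ((f ^ toℕ k) x))
        d , i+1+d≡j = m≤n⇒∃[o]m+o≡n i<j
    in d , ^-injective (toℕ i) (begin
      (f ^ toℕ i) ((f ^ suc d) x)  ≡⟨ ^-homo-at (toℕ i) (suc d) x ⟨
      (f ^ (toℕ i + suc d)) x      ≡⟨ cong (λ k → (f ^ k) x) (trans (+-suc _ d) i+1+d≡j) ⟩
      (f ^ toℕ j) x                ≡⟨ ↔-injective fin fⁱ≡fʲ ⟨
      (f ^ toℕ i) x                ∎)
    where open ≡-Reasoning

  preserved⇒reflected : ∀ {n} → A ↔ Fin n → (P : A → Set) →
                        (∀ {x} → P x → P (f x)) → ∀ {x} → P (f x) → P x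
  preserved⇒reflected fin P preserve {x} Pfx =
    let d , fᵈ⁺¹x≡x = finitePerm-periodic fin x in
    subst P (trans (shift d) fᵈ⁺¹x≡x) (iterate d Pfx)
    where
    iterate : ∀ k {y} → P y → P ((f ^ k) y)
    iterate zero    p = p
    iterate (suc k) p = preserve (iterate k p)

    shift : ∀ k → (f ^ k) (f x) ≡ (f ^ suc k) x
    shift k = trans (sym (^-homo-at k 1 x)) (cong (λ m → (f ^ m) x) (+-comm k 1))

TwoFoldHom : {A : Set} → (A → A → Set) → Perm A → Perm A → Set
TwoFoldHom R α β = ∀ {u v} → R u v → R (α ⟨$⟩ u) (β ⟨$⟩ v)

twoFoldHom-reflects : ∀ {A n} → A ↔ Fin n → {R : A → A → Set} {α β : Perm A} →
                      TwoFoldHom R α β → ∀ {u v} → R (α ⟨$⟩ u) (β ⟨$⟩ v) → R u v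
twoFoldHom-reflects fin {R} {α} {β} hom {u} {v} =
  preserved⇒reflected (α ×-↔ β) (↔-trans (fin ×-↔ fin) (↔-sym *↔×)) (uncurry R) hom {u , v}

twoFoldHom-swap : {A : Set} {R : A → A → Set} {α β : Perm A} →
                  (∀ {u v} → R u v → R v u) → TwoFoldHom R α β → TwoFoldHom R β α
twoFoldHom-swap R-sym hom s = R-sym (hom (R-sym s))

twoFoldHom-≡ : {A : Set} (γ : Perm A) → TwoFoldHom _≡_ γ γ
twoFoldHom-≡ γ = cong (γ ⟨$⟩_)

infix 4 _≉_
_≉_ : {A : Set} → Perm A → Perm A → Set
α ≉ β = ¬ (∀ x → α ⟨$⟩ x ≡ β ⟨$⟩ x)

endo⇒aut : (Λ : Graph) (φ : Perm (V Λ)) → IsTF Λ φ φ → IsAut Λ φ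
endo⇒aut Λ φ hom u v =
  mk⇔ (hom {u} {v}) (twoFoldHom-reflects (finite Λ) {_∼_ Λ} {φ} {φ} hom)

fibreʳ : {A B : Set} → (A → Perm B) → Perm (A × B)
fibreʳ f = mk↔ₛ′ (λ (a , x) → a , f a ⟨$⟩ x) (λ (a , y) → a , Inverse.from (f a) y)
  (λ (a , y) → cong (a ,_) (Inverse.strictlyInverseˡ (f a) y))
  (λ (a , x) → cong (a ,_) (Inverse.strictlyInverseʳ (f a) x))

fibreˡ : {A B : Set} → (B → Perm A) → Perm (A × B)
fibreˡ f = ↔-trans (×-comm _ _) (↔-trans (fibreʳ f) (×-comm _ _))

fibreʳ-≉ : {A B : Set} {f g : A → Perm B} (a : A) → f a ≉ g a → fibreʳ f ≉ fibreʳ g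
fibreʳ-≉ a fa≉ga fibres≗ = fa≉ga (λ x → cong proj₂ (fibres≗ (a , x)))

fibreˡ-≉ : {A B : Set} {f g : B → Perm A} (x : B) → f x ≉ g x → fibreˡ f ≉ fibreˡ g
fibreˡ-≉ x fx≉gx fibres≗ = fx≉gx (λ a → cong proj₁ (fibres≗ (a , x)))

infix 8 _⊗id id⊗_
_⊗id : {A B : Set} → Perm A → Perm (A × B)
α ⊗id = fibreˡ (λ _ → α)

id⊗_ : {A B : Set} → Perm B → Perm (A × B)
id⊗ α = fibreʳ (λ _ → α)

⊗id-hom : {A B : Set} (R : A → A → Set) (S : B → B → Set) {α β : Perm A} →
          TwoFoldHom R α β → TwoFoldHom (Pointwise R S) (α ⊗id) (β ⊗id)
⊗id-hom R S hom (r , s) = hom r , s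

id⊗-hom : {A B : Set} (R : A → A → Set) (S : B → B → Set) {α β : Perm B} →
          TwoFoldHom S α β → TwoFoldHom (Pointwise R S) (id⊗ α) (id⊗ β)
id⊗-hom R S hom (r , s) = r , hom s

⊗id-≉ : {A B : Set} {α β : Perm A} → B → α ≉ β → _⊗id {B = B} α ≉ β ⊗id
⊗id-≉ {α = α} {β} = fibreˡ-≉ {f = λ _ → α} {λ _ → β}

id⊗-≉ : {A B : Set} {α β : Perm B} → A → α ≉ β → id⊗_ {A} α ≉ id⊗ β
id⊗-≉ {α = α} {β} = fibreʳ-≉ {f = λ _ → α} {λ _ → β}

twist : {A B : Set} → (A → Bool) → Perm B → Perm B → A → Perm B
twist c α β a = if c a then β else α

module _ {A B : Set} (c : A → Bool) (α β : Perm B) where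

  twist-≉ : α ≉ β → ∀ a → twist c α β a ≉ twist c β α a
  twist-≉ α≉β a with c a
  ... | false = α≉β
  ... | true  = λ β≗α → α≉β (sym ∘ β≗α)

  twist-vertex : {S : B → B → Set} → (∀ {x y} → S x y → S y x) →
                 TwoFoldHom S α β → ∀ a → TwoFoldHom S (twist c α β a) (twist c β α a)
  twist-vertex {S} S-sym hom a with c a
  ... | false = hom
  ... | true  = twoFoldHom-swap {R = S} {α} {β} S-sym hom

  twist-edge : {S : B → B → Set} → TwoFoldHom S α α → TwoFoldHom S β β →
               ∀ {a b} → c a ≢ c b → TwoFoldHom S (twist c α β a) (twist c β α b)
  twist-edge homα homβ {a} {b} ca≢cb with c a | c b
  ... | false | true  = homα
  ... | true  | false = homβ
  ... | false | false = contradiction refl ca≢cb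
  ... | true  | true  = contradiction refl ca≢cb

  twist-edge-≗ : ∀ {a b} → c a ≢ c b → ∀ x → twist c α β a ⟨$⟩ x ≡ twist c β α b ⟨$⟩ x
  twist-edge-≗ ca≢cb x = twist-edge {_≡_} (twoFoldHom-≡ α) (twoFoldHom-≡ β) ca≢cb {x} refl

  fibreʳ-twist-≉ : α ≉ β → A → fibreʳ (twist c α β) ≉ fibreʳ (twist c β α)
  fibreʳ-twist-≉ α≉β a = fibreʳ-≉ {f = twist c α β} {twist c β α} a (twist-≉ α≉β a)

  fibreˡ-twist-≉ : α ≉ β → A → fibreˡ (twist c α β) ≉ fibreˡ (twist c β α)
  fibreˡ-twist-≉ α≉β x = fibreˡ-≉ {f = twist c α β} {twist c β α} x (twist-≉ α≉β x)

module _ {A : Set} (_≟_ : DecidableEquality A) (u v : A) where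

  transpose : A → A
  transpose x with x ≟ u
  ... | yes _ = v
  ... | no _ with x ≟ v
  ...   | yes _ = u
  ...   | no _  = x

  transpose-u : transpose u ≡ v
  transpose-u with u ≟ u
  ... | yes _   = refl
  ... | no u≢u  = contradiction refl u≢u

  transpose-v : transpose v ≡ u
  transpose-v with v ≟ u
  ... | yes v≡u = v≡u
  ... | no _ with v ≟ v
  ...   | yes _  = refl
  ...   | no v≢v = contradiction refl v≢v

  transpose-fixes : ∀ {x} → x ≢ u → x ≢ v → transpose x ≡ x
  transpose-fixes {x} x≢u x≢v with x ≟ u
  ... | yes x≡u = contradiction x≡u x≢u
  ... | no _ with x ≟ v
  ...   | yes x≡v = contradiction x≡v x≢v
  ...   | no _    = refl

  transpose-involutive : ∀ x → transpose (transpose x) ≡ x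
  transpose-involutive x with x ≟ u
  ... | yes x≡u = trans transpose-v (sym x≡u)
  ... | no x≢u with x ≟ v
  ...   | yes x≡v = trans transpose-u (sym x≡v)
  ...   | no x≢v  = transpose-fixes x≢u x≢v

  transposition : Perm A
  transposition = mk↔ₛ′ transpose transpose transpose-involutive transpose-involutive

  transpose-related : (R : A → A → Set) → (∀ {x} → R x x) → R u v → R v u →
                      ∀ x → R x (transpose x)
  transpose-related R R-refl Ruv Rvu x with x ≟ u
  ... | yes refl = Ruv
  ... | no _ with x ≟ v
  ...   | yes refl = Rvu
  ...   | no _     = R-refl

module _ (Λ : Graph) {u v : V Λ} (u≢v : u ≢ v) (twins : ∀ w → (_∼_ Λ w u ⇔ _∼_ Λ w v)) where

  private
    _≟_ : DecidableEquality (V Λ)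
    _≟_ = inj⇒≟ (↔⇒↣ (finite Λ))

  twinSwap : Perm (V Λ)
  twinSwap = transposition _≟_ u v

  id-twinSwap-TF : IsTF Λ ↔-refl twinSwap
  id-twinSwap-TF {x} {y} = transpose-related _≟_ u v
    (λ a b → ∀ {w} → _∼_ Λ w a → _∼_ Λ w b) (λ w∼a → w∼a)
    (Equivalence.to (twins _)) (Equivalence.from (twins _)) y

  twinSwap-endo : IsTF Λ twinSwap twinSwap
  twinSwap-endo x∼y = ∼-sym Λ (id-twinSwap-TF (∼-sym Λ (id-twinSwap-TF x∼y)))

  id≉twinSwap : ↔-refl ≉ twinSwap
  id≉twinSwap id≗τ = u≢v (trans (id≗τ u) (transpose-u _≟_ u v))

nontrivialTF⇒unstable : (Λ : Graph) → HasNontrivialTF Λ → Unstable Λ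
nontrivialTF⇒unstable Λ (α , β , tf , α≉β) = (Φ , Φ-aut) , notProduct
  where
  Φ : Perm (V Λ × Bool)
  Φ = fibreˡ (λ b → if b then β else α)

  Φ-endo : IsTF (Λ ×K₂) Φ Φ
  Φ-endo {_ , false} {_ , true}  (x∼y , b≢b′) = tf x∼y , b≢b′
  Φ-endo {_ , true}  {_ , false} (x∼y , b≢b′) =
    twoFoldHom-swap {R = _∼_ Λ} {α} {β} (∼-sym Λ) tf x∼y , b≢b′
  Φ-endo {_ , false} {_ , false} (_ , b≢b′)   = contradiction refl b≢b′
  Φ-endo {_ , true}  {_ , true}  (_ , b≢b′)   = contradiction refl b≢b′

  Φ-aut : IsAut (Λ ×K₂) Φ
  Φ-aut = endo⇒aut (Λ ×K₂) Φ Φ-endo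

  notProduct : ¬ InProductAut Λ (Φ , Φ-aut)
  notProduct (_ , _ , Φ≗σ×τ) =
    α≉β (λ x → trans (cong proj₁ (Φ≗σ×τ (x , false))) (sym (cong proj₁ (Φ≗σ×τ (x , true)))))

productShaped⇒InProductAut : (Λ : Graph) (φ : Aut (Λ ×K₂)) (f : V Λ → V Λ) (τ : Aut K₂) →
  (∀ p → proj₁ φ ⟨$⟩ p ≡ (f (proj₁ p) , proj₁ τ ⟨$⟩ proj₂ p)) → InProductAut Λ φ
productShaped⇒InProductAut Λ (φ , φ-aut) f τ φ≗f×τ = (σ , endo⇒aut Λ σ σ-endo) , τ , φ≗f×τ
  where
  f⁻¹ : V Λ → V Λ
  f⁻¹ y = proj₁ (Inverse.from φ (y , proj₁ τ ⟨$⟩ false))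

  σ : Perm (V Λ)
  σ = mk↔ₛ′ f f⁻¹
    (λ y → cong proj₁ (trans (sym (φ≗f×τ _))
                             (Inverse.strictlyInverseˡ φ (y , proj₁ τ ⟨$⟩ false))))
    (λ x → cong proj₁ (trans (cong (Inverse.from φ) (sym (φ≗f×τ (x , false))))
                             (Inverse.strictlyInverseʳ φ (x , false))))

  σ-endo : IsTF Λ σ σ
  σ-endo {x} {y} x∼y =
    subst₂ (_∼_ Λ) (cong proj₁ (φ≗f×τ (x , false))) (cong proj₁ (φ≗f×τ (y , true)))
      (proj₁ (Equivalence.to (φ-aut (x , false) (y , true)) (x∼y , λ ())))

⋉-unstable : (Γ Σ : Graph) → V Γ → Unstable Σ → Unstable (Γ ⋉ Σ)
⋉-unstable Γ Σ a₀ ((φ , φ-aut) , notProduct) = (Φ , Φ-aut) , notProduct ∘ restrict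
  where
  Φ : Perm ((V Γ × V Σ) × Bool)
  Φ = ↔-trans (×-assoc 0ℓ _ _ _) (↔-trans (↔-refl ×-↔ φ) (↔-sym (×-assoc 0ℓ _ _ _)))

  Φ-endo : IsTF ((Γ ⋉ Σ) ×K₂) Φ Φ
  Φ-endo {(_ , x) , b} {(_ , y) , b′} ((a≃a′ , x∼y) , b≢b′) =
    let φx∼φy , φb≢φb′ = Equivalence.to (φ-aut (x , b) (y , b′)) (x∼y , b≢b′)
    in (a≃a′ , φx∼φy) , φb≢φb′

  Φ-aut : IsAut ((Γ ⋉ Σ) ×K₂) Φ
  Φ-aut = endo⇒aut ((Γ ⋉ Σ) ×K₂) Φ Φ-endo

  restrict : InProductAut (Γ ⋉ Σ) (Φ , Φ-aut) → InProductAut Σ (φ , φ-aut)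
  restrict (σ , τ , Φ≗σ×τ) =
    productShaped⇒InProductAut Σ (φ , φ-aut) (λ x → proj₂ (proj₁ σ ⟨$⟩ (a₀ , x))) τ
      (λ (x , b) → cong₂ _,_ (cong (proj₂ ∘ proj₁) (Φ≗σ×τ ((a₀ , x) , b)))
                             (cong proj₂ (Φ≗σ×τ ((a₀ , x) , b))))

HasNontrivialTFOfEndos : Graph → Set
HasNontrivialTFOfEndos Λ = Σ (Perm (V Λ)) λ α → Σ (Perm (V Λ)) λ β →
  IsTF Λ α β × IsTF Λ α α × IsTF Λ β β × α ≉ β

RThick⇒nontrivialTFOfEndos : (Λ : Graph) → RThick Λ → HasNontrivialTFOfEndos Λ
RThick⇒nontrivialTFOfEndos Λ (_ , _ , u≢v , twins) =
  ↔-refl , twinSwap Λ u≢v twins , id-twinSwap-TF Λ u≢v twins , (λ x∼y → x∼y) ,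
  twinSwap-endo Λ u≢v twins , id≉twinSwap Λ u≢v twins

module _ (Γ Σ : Graph) where

  □-nontrivialTFˡ : V Γ → Bipartite Γ → HasNontrivialTF Σ → HasNontrivialTF (Γ □ Σ)
  □-nontrivialTFˡ a₀ (c , proper) (α , β , tf , α≉β) =
    fibreʳ (twist c α β) , fibreʳ (twist c β α) , hom , fibreʳ-twist-≉ c α β α≉β a₀
    where
    hom : IsTF (Γ □ Σ) (fibreʳ (twist c α β)) (fibreʳ (twist c β α))
    hom {a , _} {_ , _} (inj₁ (refl , x∼y)) =
      inj₁ (refl , twist-vertex c α β {_∼_ Σ} (∼-sym Σ) tf a x∼y)
    hom {_ , x} {_ , _} (inj₂ (a∼b , refl)) =
      inj₂ (a∼b , twist-edge-≗ c α β (proper a∼b) x)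

  □-nontrivialTFʳ : V Σ → Bipartite Σ → HasNontrivialTF Γ → HasNontrivialTF (Γ □ Σ)
  □-nontrivialTFʳ x₀ (c , proper) (α , β , tf , α≉β) =
    fibreˡ (twist c α β) , fibreˡ (twist c β α) , hom , fibreˡ-twist-≉ c α β α≉β x₀
    where
    hom : IsTF (Γ □ Σ) (fibreˡ (twist c α β)) (fibreˡ (twist c β α))
    hom {a , _} {_ , _} (inj₁ (refl , x∼y)) =
      inj₁ (twist-edge-≗ c α β (proper x∼y) a , x∼y)
    hom {_ , x} {_ , _} (inj₂ (a∼b , refl)) =
      inj₂ (twist-vertex c α β {_∼_ Γ} (∼-sym Γ) tf x a∼b , refl)

  ⊠-nontrivialTFˡ : V Γ → Bipartite Γ → HasNontrivialTFOfEndos Σ → HasNontrivialTF (Γ ⊠ Σ)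
  ⊠-nontrivialTFˡ a₀ (c , proper) (α , β , tf , endoα , endoβ , α≉β) =
    fibreʳ (twist c α β) , fibreʳ (twist c β α) , hom , fibreʳ-twist-≉ c α β α≉β a₀
    where
    hom : IsTF (Γ ⊠ Σ) (fibreʳ (twist c α β)) (fibreʳ (twist c β α))
    hom {a , _} {_ , _} (inj₁ (refl , x∼y)) =
      inj₁ (refl , twist-vertex c α β {_∼_ Σ} (∼-sym Σ) tf a x∼y)
    hom (inj₂ (inj₁ (a∼b , x∼y))) =
      inj₂ (inj₁ (a∼b , twist-edge c α β {_∼_ Σ} endoα endoβ (proper a∼b) x∼y))
    hom {_ , x} {_ , _} (inj₂ (inj₂ (a∼b , refl))) =
      inj₂ (inj₂ (a∼b , twist-edge-≗ c α β (proper a∼b) x))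

  ⊠-nontrivialTFʳ : V Σ → Bipartite Σ → HasNontrivialTFOfEndos Γ → HasNontrivialTF (Γ ⊠ Σ)
  ⊠-nontrivialTFʳ x₀ (c , proper) (α , β , tf , endoα , endoβ , α≉β) =
    fibreˡ (twist c α β) , fibreˡ (twist c β α) , hom , fibreˡ-twist-≉ c α β α≉β x₀
    where
    hom : IsTF (Γ ⊠ Σ) (fibreˡ (twist c α β)) (fibreˡ (twist c β α))
    hom {a , _} {_ , _} (inj₁ (refl , x∼y)) =
      inj₁ (twist-edge-≗ c α β (proper x∼y) a , x∼y)
    hom (inj₂ (inj₁ (a∼b , x∼y))) =
      inj₂ (inj₁ (twist-edge c α β {_∼_ Γ} endoα endoβ (proper x∼y) a∼b , x∼y))
    hom {_ , x} {_ , _} (inj₂ (inj₂ (a∼b , refl))) =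
      inj₂ (inj₂ (twist-vertex c α β {_∼_ Γ} (∼-sym Γ) tf x a∼b , refl))

AdjOrEq : (Λ : Graph) → V Λ → V Λ → Set
AdjOrEq Λ = _∼_ Λ ∪ _≡_

module _ (Λ : Graph) {α β : Perm (V Λ)} (tfs : IsTFS Λ α β) where

  TFS⇒adjOrEq-hom : TwoFoldHom (AdjOrEq Λ) α β
  TFS⇒adjOrEq-hom (inj₁ u∼v)  = proj₂ tfs u∼v
  TFS⇒adjOrEq-hom (inj₂ refl) = inj₁ (proj₁ tfs _)

  TFS⇒≉ : V Λ → α ≉ β
  TFS⇒≉ u α≗β = ∼-irr Λ (subst (λ w → _∼_ Λ w (β ⟨$⟩ u)) (α≗β u) (proj₁ tfs u))

complement-TF : (Λ : Graph) {α β : Perm (V Λ)} →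
                TwoFoldHom (AdjOrEq Λ) α β → IsTF (complement Λ) α β
complement-TF Λ {α} {β} hom (u≢v , u≁v) = ¬adjOrEq ∘ inj₂ , ¬adjOrEq ∘ inj₁
  where
  ¬adjOrEq : ¬ AdjOrEq Λ _ _
  ¬adjOrEq = [ u≁v , u≢v ]′ ∘ twoFoldHom-reflects (finite Λ) {AdjOrEq Λ} {α} {β} hom

⊠-adjOrEq : (Γ Σ : Graph) {p q : V Γ × V Σ} →
            AdjOrEq (Γ ⊠ Σ) p q ⇔ Pointwise (AdjOrEq Γ) (AdjOrEq Σ) p q
⊠-adjOrEq Γ Σ = mk⇔
  (λ { (inj₁ (inj₁ (a≡b , x∼y)))        → inj₂ a≡b , inj₁ x∼y
     ; (inj₁ (inj₂ (inj₁ (a∼b , x∼y)))) → inj₁ a∼b , inj₁ x∼y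
     ; (inj₁ (inj₂ (inj₂ (a∼b , x≡y)))) → inj₁ a∼b , inj₂ x≡y
     ; (inj₂ refl)                      → inj₂ refl , inj₂ refl })
  (λ { (inj₂ a≡b , inj₁ x∼y) → inj₁ (inj₁ (a≡b , x∼y))
     ; (inj₁ a∼b , inj₁ x∼y) → inj₁ (inj₂ (inj₁ (a∼b , x∼y)))
     ; (inj₁ a∼b , inj₂ x≡y) → inj₁ (inj₂ (inj₂ (a∼b , x≡y)))
     ; (inj₂ a≡b , inj₂ x≡y) → inj₂ (cong₂ _,_ a≡b x≡y) })

module _ (Γ Σ : Graph) where

  complement-⊠-TF : {P Q : Perm (V Γ × V Σ)} →
    TwoFoldHom (Pointwise (AdjOrEq Γ) (AdjOrEq Σ)) P Q → IsTF (complement (Γ ⊠ Σ)) P Q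
  complement-⊠-TF {P} {Q} hom = complement-TF (Γ ⊠ Σ) {P} {Q}
    (Equivalence.from (⊠-adjOrEq Γ Σ) ∘ hom ∘ Equivalence.to (⊠-adjOrEq Γ Σ))

  complement-⊠-nontrivialTF : V Γ → V Σ → HasTFS Γ ⊎ HasTFS Σ →
                              HasNontrivialTF (complement (Γ ⊠ Σ))
  complement-⊠-nontrivialTF a₀ x₀ (inj₁ (α , β , tfs)) =
    α ⊗id , β ⊗id ,
    complement-⊠-TF {α ⊗id} {β ⊗id}
      (⊗id-hom (AdjOrEq Γ) (AdjOrEq Σ) {α} {β} (TFS⇒adjOrEq-hom Γ {α} {β} tfs)) ,
    ⊗id-≉ {α = α} {β} x₀ (TFS⇒≉ Γ {α} {β} tfs a₀)
  complement-⊠-nontrivialTF a₀ x₀ (inj₂ (α , β , tfs)) =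
    id⊗ α , id⊗ β ,
    complement-⊠-TF {id⊗ α} {id⊗ β}
      (id⊗-hom (AdjOrEq Γ) (AdjOrEq Σ) {α} {β} (TFS⇒adjOrEq-hom Σ {α} {β} tfs)) ,
    id⊗-≉ {α = α} {β} a₀ (TFS⇒≉ Σ {α} {β} tfs x₀)

  ⋉-nontrivialTF : V Γ → V Σ → HasTFS Γ → HasNontrivialTF (Γ ⋉ Σ)
  ⋉-nontrivialTF a₀ x₀ (α , β , tfs) =
    α ⊗id , β ⊗id ,
    ⊗id-hom (AdjOrEq Γ) (_∼_ Σ) {α} {β} (TFS⇒adjOrEq-hom Γ {α} {β} tfs) ,
    ⊗id-≉ {α = α} {β} x₀ (TFS⇒≉ Γ {α} {β} tfs a₀)

  lex-nontrivialTF : V Γ → HasNontrivialTF Σ → HasNontrivialTF (lex Γ Σ)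
  lex-nontrivialTF a₀ (α , β , tf , α≉β) = id⊗ α , id⊗ β , hom , id⊗-≉ {α = α} {β} a₀ α≉β
    where
    hom : IsTF (lex Γ Σ) (id⊗ α) (id⊗ β)
    hom (inj₁ a∼b)          = inj₁ a∼b
    hom (inj₂ (a≡b , x∼y)) = inj₂ (a≡b , tf x∼y)

theorem1p3 : (Γ Σ : Graph) →
    Connected Γ → Connected Σ →
    AtLeastTwoVertices Γ → AtLeastTwoVertices Σ →
      (((Bipartite Γ × HasNontrivialTF Σ) ⊎ (Bipartite Σ × HasNontrivialTF Γ)) → Unstable (Γ □ Σ))
    × (((Bipartite Γ × RThick Σ) ⊎ (Bipartite Σ × RThick Γ)) → Unstable (Γ ⊠ Σ))
    × ((HasTFS Γ ⊎ HasTFS Σ) → Unstable (complement (Γ ⊠ Σ)))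
    × ((Unstable Σ ⊎ HasTFS Γ) → Unstable (Γ ⋉ Σ))
    × (HasNontrivialTF Σ → Unstable (lex Γ Σ))
theorem1p3 Γ Σ _ _ (a₀ , _) (x₀ , _) =
    nontrivialTF⇒unstable (Γ □ Σ) ∘
      [ uncurry (□-nontrivialTFˡ Γ Σ a₀) , uncurry (□-nontrivialTFʳ Γ Σ x₀) ]′
  , nontrivialTF⇒unstable (Γ ⊠ Σ) ∘
      [ (λ (bip , thick) → ⊠-nontrivialTFˡ Γ Σ a₀ bip (RThick⇒nontrivialTFOfEndos Σ thick))
      , (λ (bip , thick) → ⊠-nontrivialTFʳ Γ Σ x₀ bip (RThick⇒nontrivialTFOfEndos Γ thick)) ]′
  , nontrivialTF⇒unstable (complement (Γ ⊠ Σ)) ∘ complement-⊠-nontrivialTF Γ Σ a₀ x₀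
  , [ ⋉-unstable Γ Σ a₀ , nontrivialTF⇒unstable (Γ ⋉ Σ) ∘ ⋉-nontrivialTF Γ Σ a₀ x₀ ]′
  , nontrivialTF⇒unstable (lex Γ Σ) ∘ lex-nontrivialTF Γ Σ a₀
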